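{- Let $A$ be an integer weighing matrix. Then $A$ is primitive if and only if the bipartite graph $\mathcal B_A$ is connected.
   Context: An integer weighing matrix is $A\in\mathbb Z^{n\times n}$ with $AA^\top=kI$ (here $k>0$). It is primitive if it is not H-equivalent (i.e. obtainable by permuting and negating rows and columns) to a block diagonal sum of two or more smaller square blocks. $\mathcal B_A$ is the bipartite graph with one vertex for each row and one for each column of $A$, with row $i$ adjacent to column $j$ iff $A_{i,j}\neq0$. -}

module Defs where

open import Data.Nat using (ℕ; zero; suc) renaming (_+_ to _+ℕ_)
open import Data.Integer using (ℤ; +_; -[1+_]; _+_; _*_; _<_; 0ℤ; 1ℤ)
open import Data.Fin using (Fin; zero; suc; splitAt; _≟_)
open import Data.Fin.Permutation using (Permutation; _⟨$⟩ʳ_)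
open import Data.Sum using (_⊎_; inj₁; inj₂)
open import Data.Product using (Σ; ∃; _×_; _,_)
open import Data.Bool using (if_then_else_)
open import Relation.Nullary using (¬_)
open import Relation.Nullary.Decidable using (⌊_⌋)
open import Relation.Binary.PropositionalEquality using (_≡_; _≢_)
open import Relation.Binary.Construct.Closure.ReflexiveTransitive using (Star)

Mat : ℕ → Set
Mat n = Fin n → Fin n → ℤ

∑ : ∀ {n} → (Fin n → ℤ) → ℤ
∑ {zero}  f = 0ℤ
∑ {suc n} f = f zero + ∑ (λ l → f (suc l))

AAᵀ : ∀ {n} → Mat n → Mat n
AAᵀ A i j = ∑ (λ l → A i l * A j l)

scalarId : ∀ {n} → ℤ → Mat n
scalarId k i j = if ⌊ i ≟ j ⌋ then k else 0ℤ

IsWeighing : ∀ {n} → Mat n → Set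
IsWeighing {n} A = Σ ℤ λ k → (0ℤ < k) × (∀ i j → AAᵀ A i j ≡ scalarId k i j)

IsSign : ℤ → Set
IsSign s = (s ≡ 1ℤ) ⊎ (s ≡ -[1+ 0 ])

HEquiv : ∀ {n m} → Mat n → Mat m → Set
HEquiv {n} {m} A M =
  Σ (Permutation m n) λ σ → Σ (Permutation m n) λ τ →
  Σ (Fin m → ℤ) λ r → Σ (Fin m → ℤ) λ c →
  (∀ i → IsSign (r i)) × (∀ j → IsSign (c j)) ×
  (∀ i j → M i j ≡ r i * c j * A (σ ⟨$⟩ʳ i) (τ ⟨$⟩ʳ j))

_⊕_ : ∀ {p q} → Mat p → Mat q → Mat (p +ℕ q)
_⊕_ {p} B C i j with splitAt p i | splitAt p j
... | inj₁ i' | inj₁ j' = B i' j'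
... | inj₂ i' | inj₂ j' = C i' j'
... | inj₁ _  | inj₂ _  = 0ℤ
... | inj₂ _  | inj₁ _  = 0ℤ

-- A is H-equivalent to a block diagonal sum of two nonempty square blocks
-- (a sum of two or more smaller blocks groups into two such blocks).
Decomposable : ∀ {n} → Mat n → Set
Decomposable A =
  Σ ℕ λ p → Σ ℕ λ q → Σ (Mat (suc p)) λ B → Σ (Mat (suc q)) λ C →
  HEquiv A (B ⊕ C)

Primitive : ∀ {n} → Mat n → Set
Primitive A = ¬ Decomposable A

-- the bipartite graph B_A: vertices inj₁ i (row i), inj₂ j (column j)
Vertex : ℕ → Set
Vertex n = Fin n ⊎ Fin n

data Adj {n} (A : Mat n) : Vertex n → Vertex n → Set where
  row-col : ∀ {i j} → A i j ≢ 0ℤ → Adj A (inj₁ i) (inj₂ j)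
  col-row : ∀ {i j} → A i j ≢ 0ℤ → Adj A (inj₂ j) (inj₁ i)

Connected : ∀ {n} → Mat n → Set
Connected {n} A = ∀ (u v : Vertex n) → Star (Adj A) u v

{-# OPTIONS --safe #-}
module Submission where

-- A block decomposition A ≅ B ⊕ C puts every row and column on the side of its block, and no edge of
-- B_A joins the two sides; so a decomposable matrix has a disconnected graph. Conversely, if v is not
-- reachable from u, putting each vertex on the side of reachability from u again keeps every edge on one
-- side, and such a separation comes from a block decomposition once each side has as many rows as
-- columns. This is where AAᵀ = kI enters: every row has squared norm k and every column squared norm
-- at most k (the j-th entry of Aᵀ(column j) is the squared norm c of column j, so
-- c² ≤ ‖Aᵀ(column j)‖² = kc). The rows on one side are supported in the columns on that side, so
-- k·#rows ≤ k·#columns on each side, and as the two sides together have n rows and n columns, equality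
-- holds. Reachability in the finite graph B_A is decidable, which makes the argument constructive.

open import Defs
open import Data.Nat using (ℕ)
open import Function.Bundles using (_⇔_)

open import Data.Nat as ℕ using (zero; suc; z≤n; s≤s) renaming (_+_ to _+ℕ_)
import Data.Nat.Properties as NP
open import Data.Integer using (ℤ; +_; -[1+_]; +[1+_]; _+_; _*_; _≤_; _<_; +≤+; 0ℤ; 1ℤ)
open import Data.Integer.Base using (positive)
import Data.Integer.Properties as ZP
open import Data.Fin using (Fin; zero; suc; punchIn; splitAt; _↑ʳ_; _≟_)
import Data.Fin.Properties as FP
open import Data.Fin.Permutation using (Permutation; _⟨$⟩ʳ_; _⟨$⟩ˡ_; inverseˡ; inverseʳ)
open import Data.Fin.Subset using (Subset; _∈_; _∉_; _∪_; ⁅_⁆; _⊃_)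
open import Data.Fin.Subset.Properties
  using (_∈?_; x∈⁅x⁆; x∈⁅y⁆⇒x≡y; p⊆p∪q; q⊆p∪q; x∈p∪q⁻)
open import Data.Fin.Subset.Induction using (⊃-wellFounded)
open import Induction.WellFounded using (Acc; acc)
open import Data.Bool using (Bool; true; false; not; if_then_else_)
open import Data.Sum using (_⊎_; inj₁; inj₂; [_,_]′)
import Data.Sum as Sum
open import Data.Product using (_×_; _,_; ∃₂)
open import Function using (_∘_; _on_; const; id; _↔_; Inverse; mk⇔; mk↔ₛ′)
open import Function.Construct.Composition using (_↔-∘_)
open import Relation.Nullary using (¬_; Dec; yes; no; ¬?; contradiction)
open import Relation.Nullary.Decidable
  using (does; map′; _×-dec_; isYes≗does; dec-true; dec-false; does-⇔; decidable-stable)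
open import Relation.Binary.Core using (Rel; _Preserves_⟶_)
open import Relation.Binary.Definitions using (Decidable)
open import Relation.Binary.PropositionalEquality
  using (_≡_; _≢_; refl; sym; trans; cong; cong₂; subst; subst₂; module ≡-Reasoning)
open import Relation.Binary.Construct.Closure.ReflexiveTransitive using (Star; ε; _◅_; _◅◅_; gmap)
open import Algebra.Properties.Semiring.Sum ZP.+-*-semiring
  using (sum; ∑-comm; *-distribˡ-sum; *-distribʳ-sum; sum-cong-≗; sum-remove; sum-replicate-zero)
open import Algebra.Properties.CommutativeSemigroup ZP.*-commutativeSemigroup using (interchange)

private
  variable
    m n : ℕ

∑≗sum : (f : Fin n → ℤ) → ∑ f ≡ sum f
∑≗sum {zero}  f = refl
∑≗sum {suc n} f = cong (λ s → f zero + s) (∑≗sum (f ∘ suc))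

sum-mono-≤ : {f g : Fin n → ℤ} → (∀ i → f i ≤ g i) → sum f ≤ sum g
sum-mono-≤ {zero}  f≤g = ZP.≤-refl
sum-mono-≤ {suc n} f≤g = ZP.+-mono-≤ (f≤g zero) (sum-mono-≤ (f≤g ∘ suc))

sum-nonneg : {f : Fin n → ℤ} → (∀ i → 0ℤ ≤ f i) → 0ℤ ≤ sum f
sum-nonneg {n} {f} f≥0 = subst (_≤ sum f) (sum-replicate-zero n) (sum-mono-≤ f≥0)

term≤sum : {f : Fin n → ℤ} → (∀ i → 0ℤ ≤ f i) → ∀ i → f i ≤ sum f
term≤sum {suc n} {f} f≥0 i = begin
  f i                        ≡⟨ ZP.+-identityʳ (f i) ⟨
  f i + 0ℤ                   ≤⟨ ZP.+-monoʳ-≤ (f i) (sum-nonneg {f = f ∘ punchIn i} (f≥0 ∘ punchIn i)) ⟩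
  f i + sum (f ∘ punchIn i)  ≡⟨ sum-remove {i = i} f ⟨
  sum f                      ∎
  where open ZP.≤-Reasoning

scalarId-diag : ∀ k (i : Fin n) → scalarId k i i ≡ k
scalarId-diag k i rewrite isYes≗does (i ≟ i) | dec-true (i ≟ i) refl = refl

scalarId-off : ∀ k {i j : Fin n} → i ≢ j → scalarId k i j ≡ 0ℤ
scalarId-off k {i} {j} i≢j rewrite isYes≗does (i ≟ j) | dec-false (i ≟ j) i≢j = refl

sum-*-scalarId : ∀ k (c : Fin n → ℤ) i → sum (λ j → c j * scalarId k i j) ≡ c i * k
sum-*-scalarId {suc n} k c i = begin
  sum (λ j → c j * scalarId k i j)
    ≡⟨ sum-remove {i = i} (λ j → c j * scalarId k i j) ⟩
  c i * scalarId k i i + sum (λ j → c (punchIn i j) * scalarId k i (punchIn i j))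
    ≡⟨ cong₂ _+_ (cong (c i *_) (scalarId-diag k i))
                 (trans (sum-cong-≗ off-diagonal) (sum-replicate-zero n)) ⟩
  c i * k + 0ℤ
    ≡⟨ ZP.+-identityʳ _ ⟩
  c i * k ∎
  where
  open ≡-Reasoning
  off-diagonal : ∀ j → c (punchIn i j) * scalarId k i (punchIn i j) ≡ 0ℤ
  off-diagonal j = trans (cong (c (punchIn i j) *_) (scalarId-off k (FP.punchInᵢ≢i i j ∘ sym)))
                         (ZP.*-zeroʳ (c (punchIn i j)))

square-nonneg : ∀ x → 0ℤ ≤ x * x
square-nonneg (+ n)    = subst (0ℤ ≤_) (sym (ZP.+◃n≡+n (n ℕ.* n))) (+≤+ z≤n)
square-nonneg -[1+ n ] = subst (0ℤ ≤_) (sym (ZP.+◃n≡+n (suc n ℕ.* suc n))) (+≤+ z≤n)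

≤-of-square-≤ : ∀ c {k} → 0ℤ ≤ c → 0ℤ ≤ k → c * c ≤ c * k → c ≤ k
≤-of-square-≤ (+ zero)   _ 0≤k _     = 0≤k
≤-of-square-≤ +[1+ m ] _ _   cc≤ck = ZP.*-cancelˡ-≤-pos +[1+ m ] _ +[1+ m ] cc≤ck

norm² : (Fin n → ℤ) → ℤ
norm² x = sum (λ i → x i * x i)

column : Mat n → Fin n → Fin n → ℤ
column A j i = A i j

_ᵀ*_ : Mat n → (Fin n → ℤ) → Fin n → ℤ
(A ᵀ* x) l = sum (λ i → x i * A i l)

mask : Bool → ℤ → ℤ
mask b x = if b then x else 0ℤ

mask-sum : ∀ b (f : Fin n → ℤ) → mask b (sum f) ≡ sum (λ i → mask b (f i))
mask-sum     true  f = refl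
mask-sum {n} false f = sym (sum-replicate-zero n)

mask-nonneg : ∀ b {x} → 0ℤ ≤ x → 0ℤ ≤ mask b x
mask-nonneg true  0≤x = 0≤x
mask-nonneg false _   = ZP.≤-refl

mask-mono : ∀ b {x y} → x ≤ y → mask b x ≤ mask b y
mask-mono true  x≤y = x≤y
mask-mono false _   = ZP.≤-refl

count : (Fin n → Bool) → ℕ
count {zero}  P = 0
count {suc n} P = if P zero then suc (count (P ∘ suc)) else count (P ∘ suc)

count-pos : (P : Fin n → Bool) {i : Fin n} → P i ≡ true → 0 ℕ.< count P
count-pos P {zero}  P0 rewrite P0 = s≤s z≤n
count-pos P {suc i} Pi with P zero
... | true  = NP.m<n⇒m<1+n (count-pos (P ∘ suc) Pi)
... | false = count-pos (P ∘ suc) Pi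

count+count∘not≡n : (P : Fin n → Bool) → count P +ℕ count (not ∘ P) ≡ n
count+count∘not≡n {zero}  P = refl
count+count∘not≡n {suc n} P with P zero
... | true  = cong suc (count+count∘not≡n (P ∘ suc))
... | false = trans (NP.+-suc _ _) (cong suc (count+count∘not≡n (P ∘ suc)))

sum-mask-const : (P : Fin n → Bool) (k : ℤ) → sum (λ i → mask (P i) k) ≡ k * + count P
sum-mask-const {zero}  P k = sym (ZP.*-zeroʳ k)
sum-mask-const {suc n} P k with P zero
... | true  = trans (cong (_+_ k) (sum-mask-const (P ∘ suc) k)) (sym (ZP.*-suc k _))
... | false = trans (ZP.+-identityˡ _) (sum-mask-const (P ∘ suc) k)

m≤o⇒n≤p⇒m+n≡o+p⇒m≡o : ∀ {m n o p} →
                      m ℕ.≤ o → n ℕ.≤ p → m +ℕ n ≡ o +ℕ p → m ≡ o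
m≤o⇒n≤p⇒m+n≡o+p⇒m≡o {m} {n} {o} {p} m≤o n≤p m+n≡o+p = NP.≤-antisym m≤o (NP.+-cancelʳ-≤ n o m o+n≤m+n)
  where
  open NP.≤-Reasoning
  o+n≤m+n : o +ℕ n ℕ.≤ m +ℕ n
  o+n≤m+n = begin
    o +ℕ n  ≤⟨ NP.+-monoʳ-≤ o n≤p ⟩
    o +ℕ p  ≡⟨ m+n≡o+p ⟨
    m +ℕ n  ∎

-- Partitions of Fin n by a predicate

record Partition (P : Fin n → Bool) (a b : ℕ) : Set where
  field
    enumeration : (Fin a ⊎ Fin b) ↔ Fin n
    to-inj₁     : ∀ x → P (Inverse.to enumeration (inj₁ x)) ≡ true
    to-inj₂     : ∀ y → P (Inverse.to enumeration (inj₂ y)) ≡ false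
  open Inverse enumeration public using (to; from; strictlyInverseˡ; strictlyInverseʳ)

module _ {P : Fin (suc n) → Bool} {a b} (π : Partition (P ∘ suc) a b) where
  open Partition π

  extend-true : P zero ≡ true → Partition P (suc a) b
  extend-true P0 = record
    { enumeration = mk↔ₛ′ to′ from′ to′∘from′ from′∘to′
    ; to-inj₁     = λ { zero → P0 ; (suc x) → to-inj₁ x }
    ; to-inj₂     = to-inj₂
    }
    where
    to′ : Fin (suc a) ⊎ Fin b → Fin (suc n)
    to′ (inj₁ zero)    = zero
    to′ (inj₁ (suc x)) = suc (to (inj₁ x))
    to′ (inj₂ y)       = suc (to (inj₂ y))
    from′ : Fin (suc n) → Fin (suc a) ⊎ Fin b
    from′ zero    = inj₁ zero
    from′ (suc i) = Sum.map₁ suc (from i)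
    to′∘from′ : ∀ i → to′ (from′ i) ≡ i
    to′∘from′ zero = refl
    to′∘from′ (suc i) with from i | strictlyInverseˡ i
    ... | inj₁ x | to-x≡i = cong suc to-x≡i
    ... | inj₂ y | to-y≡i = cong suc to-y≡i
    from′∘to′ : ∀ s → from′ (to′ s) ≡ s
    from′∘to′ (inj₁ zero)    = refl
    from′∘to′ (inj₁ (suc x)) = cong (Sum.map₁ suc) (strictlyInverseʳ (inj₁ x))
    from′∘to′ (inj₂ y)       = cong (Sum.map₁ suc) (strictlyInverseʳ (inj₂ y))

  extend-false : P zero ≡ false → Partition P a (suc b)
  extend-false P0 = record
    { enumeration = mk↔ₛ′ to′ from′ to′∘from′ from′∘to′
    ; to-inj₁     = to-inj₁
    ; to-inj₂     = λ { zero → P0 ; (suc y) → to-inj₂ y }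
    }
    where
    to′ : Fin a ⊎ Fin (suc b) → Fin (suc n)
    to′ (inj₁ x)       = suc (to (inj₁ x))
    to′ (inj₂ zero)    = zero
    to′ (inj₂ (suc y)) = suc (to (inj₂ y))
    from′ : Fin (suc n) → Fin a ⊎ Fin (suc b)
    from′ zero    = inj₂ zero
    from′ (suc i) = Sum.map₂ suc (from i)
    to′∘from′ : ∀ i → to′ (from′ i) ≡ i
    to′∘from′ zero = refl
    to′∘from′ (suc i) with from i | strictlyInverseˡ i
    ... | inj₁ x | to-x≡i = cong suc to-x≡i
    ... | inj₂ y | to-y≡i = cong suc to-y≡i
    from′∘to′ : ∀ s → from′ (to′ s) ≡ s
    from′∘to′ (inj₁ x)       = cong (Sum.map₂ suc) (strictlyInverseʳ (inj₁ x))
    from′∘to′ (inj₂ zero)    = refl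
    from′∘to′ (inj₂ (suc y)) = cong (Sum.map₂ suc) (strictlyInverseʳ (inj₂ y))

partition : (P : Fin n → Bool) → Partition P (count P) (count (not ∘ P))
partition {zero} P = record
  { enumeration = mk↔ₛ′ (λ { (inj₁ ()) ; (inj₂ ()) }) (λ ()) (λ ()) (λ { (inj₁ ()) ; (inj₂ ()) })
  ; to-inj₁     = λ ()
  ; to-inj₂     = λ ()
  }
partition {suc n} P with P zero in P0
... | true  = extend-true  (partition (P ∘ suc)) P0
... | false = extend-false (partition (P ∘ suc)) P0

-- Reachability in finite graphs

ClosedUnder : ∀ {ℓ} → Rel (Fin m) ℓ → Subset m → Set ℓ
ClosedUnder R S = ∀ {x y} → x ∈ S → R x y → y ∈ S

Star-closed : ∀ {ℓ} {R : Rel (Fin m) ℓ} {S x y} → ClosedUnder R S → x ∈ S → Star R x y → y ∈ S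
Star-closed closed x∈S ε        = x∈S
Star-closed closed x∈S (r ◅ rs) = Star-closed closed (closed x∈S r) rs

exit-or-closed : ∀ {ℓ} {R : Rel (Fin m) ℓ} → Decidable R → ∀ S →
                 (∃₂ λ x y → x ∈ S × y ∉ S × R x y) ⊎ ClosedUnder R S
exit-or-closed R? S with FP.any? (λ x → FP.any? (λ y → x ∈? S ×-dec ¬? (y ∈? S) ×-dec R? x y))
... | yes exit = inj₁ exit
... | no ¬exit = inj₂ λ {x} {y} x∈S xRy →
  decidable-stable (y ∈? S) (λ y∉S → ¬exit (x , y , x∈S , y∉S , xRy))

reachable? : ∀ {ℓ} {R : Rel (Fin m) ℓ} → Decidable R → Decidable (Star R)
reachable? {R = R} R? u v = search ⁅ u ⁆ (⊃-wellFounded ⁅ u ⁆) (x∈⁅x⁆ u) reach-singleton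
  where
  reach-singleton : ∀ {y} → y ∈ ⁅ u ⁆ → Star R u y
  reach-singleton y∈u = subst (Star R u) (sym (x∈⁅y⁆⇒x≡y u y∈u)) ε
  search : ∀ S → Acc _⊃_ S → u ∈ S → (∀ {y} → y ∈ S → Star R u y) → Dec (Star R u v)
  search S (acc larger) u∈S reach with exit-or-closed R? S
  ... | inj₂ closed = map′ reach (Star-closed closed u∈S) (v ∈? S)
  ... | inj₁ (x , y , x∈S , y∉S , xRy) =
    search (S ∪ ⁅ y ⁆) (larger S⊂S∪y) (p⊆p∪q ⁅ y ⁆ u∈S) reach′
    where
    S⊂S∪y : (S ∪ ⁅ y ⁆) ⊃ S
    S⊂S∪y = p⊆p∪q ⁅ y ⁆ , y , q⊆p∪q S ⁅ y ⁆ (x∈⁅x⁆ y) , y∉S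
    reach′ : ∀ {z} → z ∈ S ∪ ⁅ y ⁆ → Star R u z
    reach′ z∈S∪y with x∈p∪q⁻ S ⁅ y ⁆ z∈S∪y
    ... | inj₁ z∈S = reach z∈S
    ... | inj₂ z∈y = subst (Star R u) (sym (x∈⁅y⁆⇒x≡y y z∈y)) (reach x∈S ◅◅ xRy ◅ ε)

reachable?-finite : ∀ {a ℓ} {V : Set a} {R : Rel V ℓ} → Fin m ↔ V → Decidable R → Decidable (Star R)
reachable?-finite {R = R} e R? u v =
  map′ toV fromV (reachable? (λ x y → R? (to x) (to y)) (from u) (from v))
  where
  open Inverse e
  toV : Star (R on to) (from u) (from v) → Star R u v
  toV u⇝v = subst₂ (Star R) (strictlyInverseˡ u) (strictlyInverseˡ v) (gmap to id u⇝v)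
  fromV : Star R u v → Star (R on to) (from u) (from v)
  fromV = gmap from (subst₂ R (sym (strictlyInverseˡ _)) (sym (strictlyInverseˡ _)))

Star-preserves : ∀ {a b ℓ} {V : Set a} {W : Set b} {R : Rel V ℓ} {f : V → W} →
                 f Preserves R ⟶ _≡_ → f Preserves Star R ⟶ _≡_
Star-preserves f-R ε        = refl
Star-preserves f-R (r ◅ rs) = trans (f-R r) (Star-preserves f-R rs)

-- The graph B_A

Adj-sym : {A : Mat n} {u v : Vertex n} → Adj A u v → Adj A v u
Adj-sym (row-col A≢0) = col-row A≢0
Adj-sym (col-row A≢0) = row-col A≢0

Adj? : (A : Mat n) → Decidable (Adj A)
Adj? A (inj₁ i) (inj₂ j) = map′ row-col (λ { (row-col A≢0) → A≢0 }) (¬? (A i j ZP.≟ 0ℤ))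
Adj? A (inj₂ j) (inj₁ i) = map′ col-row (λ { (col-row A≢0) → A≢0 }) (¬? (A i j ZP.≟ 0ℤ))
Adj? A (inj₁ _) (inj₁ _) = no λ ()
Adj? A (inj₂ _) (inj₂ _) = no λ ()

walk? : (A : Mat n) → Decidable (Star (Adj A))
walk? A = reachable?-finite FP.+↔⊎ (Adj? A)

record Separation (A : Mat n) : Set where
  field
    side        : Vertex n → Bool
    side-adj    : side Preserves Adj A ⟶ _≡_
    inner outer : Vertex n
    inner-true  : side inner ≡ true
    outer-false : side outer ≡ false

sides-differ : ∀ {x y} → x ≡ true → y ≡ false → x ≢ y
sides-differ refl refl ()

off-block-zero : {A : Mat n} {side : Vertex n → Bool} → side Preserves Adj A ⟶ _≡_ →
                 ∀ {i j} → side (inj₁ i) ≢ side (inj₂ j) → A i j ≡ 0ℤ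
off-block-zero {A = A} side-adj {i} {j} sides≢ =
  decidable-stable (A i j ZP.≟ 0ℤ) (λ A≢0 → sides≢ (side-adj (row-col A≢0)))

separation⇒¬connected : {A : Mat n} → Separation A → ¬ Connected A
separation⇒¬connected sep connected =
  sides-differ inner-true outer-false (Star-preserves side-adj (connected inner outer))
  where open Separation sep

unreachable⇒separation : {A : Mat n} {u v : Vertex n} → ¬ Star (Adj A) u v → Separation A
unreachable⇒separation {A = A} {u} {v} ¬u⇝v = record
  { side        = λ w → does (walk? A u w)
  ; side-adj    = λ adj → does-⇔ (mk⇔ (λ u⇝w → u⇝w ◅◅ adj ◅ ε) (λ u⇝x → u⇝x ◅◅ Adj-sym adj ◅ ε))
                                 (walk? A u _) (walk? A u _)
  ; inner       = u
  ; outer       = v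
  ; inner-true  = dec-true (walk? A u u) ε
  ; outer-false = dec-false (walk? A u v) ¬u⇝v
  }

-- Block decompositions

inFirstBlock : ∀ p {q} → Fin (p +ℕ q) → Bool
inFirstBlock p i = [ const true , const false ]′ (splitAt p i)

⊕-nonzero⇒sameBlock : ∀ {p q} (B : Mat p) (C : Mat q) i j →
                      (B ⊕ C) i j ≢ 0ℤ → inFirstBlock p i ≡ inFirstBlock p j
⊕-nonzero⇒sameBlock {p} B C i j BC≢0 with splitAt p i | splitAt p j
... | inj₁ _ | inj₁ _ = refl
... | inj₂ _ | inj₂ _ = refl
... | inj₁ _ | inj₂ _ = contradiction refl BC≢0
... | inj₂ _ | inj₁ _ = contradiction refl BC≢0

sign≢0 : ∀ {s} → IsSign s → s ≢ 0ℤ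
sign≢0 (inj₁ refl) ()
sign≢0 (inj₂ refl) ()

signed≢0 : ∀ {r c a} → IsSign r → IsSign c → a ≢ 0ℤ → r * c * a ≢ 0ℤ
signed≢0 {r} {c} r-sign c-sign a≢0 rca≡0 with ZP.i*j≡0⇒i≡0∨j≡0 (r * c) rca≡0
... | inj₂ a≡0 = a≢0 a≡0
... | inj₁ rc≡0 with ZP.i*j≡0⇒i≡0∨j≡0 r rc≡0
...   | inj₁ r≡0 = sign≢0 r-sign r≡0
...   | inj₂ c≡0 = sign≢0 c-sign c≡0

decomposable⇒separation : {A : Mat n} → Decomposable A → Separation A
decomposable⇒separation {n} {A} (p , q , B , C , σ , τ , r , c , r-sign , c-sign , M≡rcA) = record
  { side        = side
  ; side-adj    = side-adj
  ; inner       = inj₁ (σ ⟨$⟩ʳ zero)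
  ; outer       = inj₁ (σ ⟨$⟩ʳ (suc p ↑ʳ zero))
  ; inner-true  = cong (inFirstBlock (suc p)) (inverseˡ σ)
  ; outer-false = trans (cong (inFirstBlock (suc p)) (inverseˡ σ))
                        (cong [ const true , const false ]′ (FP.splitAt-↑ʳ (suc p) (suc q) zero))
  }
  where
  side : Vertex n → Bool
  side (inj₁ i) = inFirstBlock (suc p) (σ ⟨$⟩ˡ i)
  side (inj₂ j) = inFirstBlock (suc p) (τ ⟨$⟩ˡ j)
  block-entry≢0 : ∀ {i j} → A i j ≢ 0ℤ → (B ⊕ C) (σ ⟨$⟩ˡ i) (τ ⟨$⟩ˡ j) ≢ 0ℤ
  block-entry≢0 A≢0 = subst (_≢ 0ℤ) (sym (M≡rcA _ _)) (signed≢0 (r-sign _) (c-sign _)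
    (subst₂ (λ i j → A i j ≢ 0ℤ) (sym (inverseʳ σ)) (sym (inverseʳ τ)) A≢0))
  side-adj : side Preserves Adj A ⟶ _≡_
  side-adj (row-col {i} {j} A≢0) =
    ⊕-nonzero⇒sameBlock B C (σ ⟨$⟩ˡ i) (τ ⟨$⟩ˡ j) (block-entry≢0 A≢0)
  side-adj (col-row {i} {j} A≢0) =
    sym (⊕-nonzero⇒sameBlock B C (σ ⟨$⟩ˡ i) (τ ⟨$⟩ˡ j) (block-entry≢0 A≢0))

decomposable-of-partitions : {A : Mat n} {side : Vertex n → Bool} → side Preserves Adj A ⟶ _≡_ →
                             ∀ {a b} → Partition (side ∘ inj₁) a b → Partition (side ∘ inj₂) a b →
                             0 ℕ.< a → 0 ℕ.< b → Decomposable A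
decomposable-of-partitions {n} {A} side-adj {suc p} {suc q} ρ κ (s≤s _) (s≤s _) =
  p , q , B , C , σ , τ , (λ _ → 1ℤ) , (λ _ → 1ℤ) , (λ _ → inj₁ refl) , (λ _ → inj₁ refl) ,
  entries
  where
  open Partition
  σ τ : Permutation (suc p +ℕ suc q) n
  σ = enumeration ρ ↔-∘ FP.+↔⊎
  τ = enumeration κ ↔-∘ FP.+↔⊎
  B : Mat (suc p)
  B x y = A (to ρ (inj₁ x)) (to κ (inj₁ y))
  C : Mat (suc q)
  C x y = A (to ρ (inj₂ x)) (to κ (inj₂ y))
  entries : ∀ i j → (B ⊕ C) i j ≡ 1ℤ * 1ℤ * A (σ ⟨$⟩ʳ i) (τ ⟨$⟩ʳ j)
  entries i j with splitAt (suc p) i | splitAt (suc p) j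
  ... | inj₁ x | inj₁ y = sym (ZP.*-identityˡ _)
  ... | inj₂ x | inj₂ y = sym (ZP.*-identityˡ _)
  ... | inj₁ x | inj₂ y = sym (trans (ZP.*-identityˡ _)
                            (off-block-zero side-adj (sides-differ (to-inj₁ ρ x) (to-inj₂ κ y))))
  ... | inj₂ x | inj₁ y = sym (trans (ZP.*-identityˡ _)
                            (off-block-zero side-adj (sides-differ (to-inj₁ κ y) (to-inj₂ ρ x) ∘ sym)))

-- Weighing matrices

module WeighingMatrix {n} (A : Mat n) (k : ℤ) (0<k : 0ℤ < k)
                      (AAᵀ≡kI : ∀ i j → sum (λ l → A i l * A j l) ≡ scalarId k i j) where

  row-norm² : ∀ i → norm² (A i) ≡ k
  row-norm² i = trans (AAᵀ≡kI i i) (scalarId-diag k i)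

  transpose-norm² : ∀ x → norm² (A ᵀ* x) ≡ norm² x * k
  transpose-norm² x = begin
    sum (λ l → (A ᵀ* x) l * (A ᵀ* x) l)
      ≡⟨ sum-cong-≗ (λ l → expand (λ i → x i * A i l)) ⟩
    sum (λ l → sum (λ i → sum (λ i′ → (x i * A i l) * (x i′ * A i′ l))))
      ≡⟨ ∑-comm (λ l i → sum (λ i′ → (x i * A i l) * (x i′ * A i′ l))) ⟩
    sum (λ i → sum (λ l → sum (λ i′ → (x i * A i l) * (x i′ * A i′ l))))
      ≡⟨ sum-cong-≗ (λ i → ∑-comm (λ l i′ → (x i * A i l) * (x i′ * A i′ l))) ⟩
    sum (λ i → sum (λ i′ → sum (λ l → (x i * A i l) * (x i′ * A i′ l))))
      ≡⟨ sum-cong-≗ (λ i → sum-cong-≗ (λ i′ → gram i i′)) ⟩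
    sum (λ i → sum (λ i′ → (x i * x i′) * scalarId k i i′))
      ≡⟨ sum-cong-≗ (λ i → sum-*-scalarId k (λ i′ → x i * x i′) i) ⟩
    sum (λ i → (x i * x i) * k)
      ≡⟨ *-distribʳ-sum k (λ i → x i * x i) ⟨
    norm² x * k ∎
    where
    open ≡-Reasoning
    expand : (f : Fin n → ℤ) → sum f * sum f ≡ sum (λ i → sum (λ i′ → f i * f i′))
    expand f = trans (*-distribʳ-sum (sum f) f) (sum-cong-≗ (λ i → *-distribˡ-sum (f i) f))
    gram : ∀ i i′ → sum (λ l → (x i * A i l) * (x i′ * A i′ l)) ≡ (x i * x i′) * scalarId k i i′
    gram i i′ = begin
      sum (λ l → (x i * A i l) * (x i′ * A i′ l))
        ≡⟨ sum-cong-≗ (λ l → interchange (x i) (A i l) (x i′) (A i′ l)) ⟩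
      sum (λ l → (x i * x i′) * (A i l * A i′ l))
        ≡⟨ *-distribˡ-sum (x i * x i′) (λ l → A i l * A i′ l) ⟨
      (x i * x i′) * sum (λ l → A i l * A i′ l)
        ≡⟨ cong (x i * x i′ *_) (AAᵀ≡kI i i′) ⟩
      (x i * x i′) * scalarId k i i′ ∎

  column-norm²≤ : ∀ j → norm² (column A j) ≤ k
  column-norm²≤ j = ≤-of-square-≤ c (sum-nonneg (λ i → square-nonneg (A i j))) (ZP.<⇒≤ 0<k) (begin
    c * c                    ≤⟨ term≤sum (λ l → square-nonneg ((A ᵀ* column A j) l)) j ⟩
    norm² (A ᵀ* column A j)  ≡⟨ transpose-norm² (column A j) ⟩
    c * k                    ∎)
    where
    open ZP.≤-Reasoning
    c = norm² (column A j)

  rows≤cols : (side : Vertex n → Bool) → side Preserves Adj A ⟶ _≡_ →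
              count (side ∘ inj₁) ℕ.≤ count (side ∘ inj₂)
  rows≤cols side side-adj = ZP.drop‿+≤+ (ZP.*-cancelˡ-≤-pos _ _ k ⦃ positive 0<k ⦄ (begin
    k * + count P
      ≡⟨ sum-mask-const P k ⟨
    sum (λ i → mask (P i) k)
      ≡⟨ sum-cong-≗ (λ i → cong (mask (P i)) (row-norm² i)) ⟨
    sum (λ i → mask (P i) (norm² (A i)))
      ≡⟨ sum-cong-≗ (λ i → mask-sum (P i) (λ j → A i j * A i j)) ⟩
    sum (λ i → sum (λ j → mask (P i) (A i j * A i j)))
      ≤⟨ sum-mono-≤ (λ i → sum-mono-≤ (masked-entry i)) ⟩
    sum (λ i → sum (λ j → mask (Q j) (A i j * A i j)))
      ≡⟨ ∑-comm (λ i j → mask (Q j) (A i j * A i j)) ⟩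
    sum (λ j → sum (λ i → mask (Q j) (A i j * A i j)))
      ≡⟨ sum-cong-≗ (λ j → mask-sum (Q j) (λ i → A i j * A i j)) ⟨
    sum (λ j → mask (Q j) (norm² (column A j)))
      ≤⟨ sum-mono-≤ (λ j → mask-mono (Q j) (column-norm²≤ j)) ⟩
    sum (λ j → mask (Q j) k)
      ≡⟨ sum-mask-const Q k ⟩
    k * + count Q ∎))
    where
    open ZP.≤-Reasoning
    P Q : Fin n → Bool
    P = side ∘ inj₁
    Q = side ∘ inj₂
    masked-entry : ∀ i j → mask (P i) (A i j * A i j) ≤ mask (Q j) (A i j * A i j)
    masked-entry i j with P i in Pi | Q j in Qj
    ... | true  | true  = ZP.≤-refl
    ... | true  | false = ZP.≤-reflexive (cong (λ a → a * a) (off-block-zero side-adj (sides-differ Pi Qj)))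
    ... | false | b     = mask-nonneg b (square-nonneg (A i j))

  rows≡cols : (side : Vertex n → Bool) → side Preserves Adj A ⟶ _≡_ →
              count (side ∘ inj₁) ≡ count (side ∘ inj₂)
  rows≡cols side side-adj = m≤o⇒n≤p⇒m+n≡o+p⇒m≡o
    (rows≤cols side side-adj)
    (rows≤cols (not ∘ side) (λ adj → cong not (side-adj adj)))
    (trans (count+count∘not≡n (side ∘ inj₁)) (sym (count+count∘not≡n (side ∘ inj₂))))

  rows-nonempty : (side : Vertex n → Bool) → side Preserves Adj A ⟶ _≡_ →
                  ∀ w → side w ≡ true → 0 ℕ.< count (side ∘ inj₁)
  rows-nonempty side side-adj (inj₁ i) side≡true = count-pos (side ∘ inj₁) side≡true
  rows-nonempty side side-adj (inj₂ j) side≡true =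
    subst (0 ℕ.<_) (sym (rows≡cols side side-adj)) (count-pos (side ∘ inj₂) side≡true)

  separation⇒decomposable : Separation A → Decomposable A
  separation⇒decomposable sep = decomposable-of-partitions side-adj
    (partition (side ∘ inj₁))
    (subst₂ (Partition (side ∘ inj₂))
            (sym (rows≡cols side side-adj)) (sym (rows≡cols (not ∘ side) not-side-adj))
            (partition (side ∘ inj₂)))
    (rows-nonempty side side-adj inner inner-true)
    (rows-nonempty (not ∘ side) not-side-adj outer (cong not outer-false))
    where
    open Separation sep
    not-side-adj : (not ∘ side) Preserves Adj A ⟶ _≡_
    not-side-adj adj = cong not (side-adj adj)

lemma4p5 : ∀ {n : ℕ} (A : Mat n) → IsWeighing A → (Primitive A ⇔ Connected A)
lemma4p5 A (k , 0<k , AAᵀ≡kI) = mk⇔ primitive⇒connected connected⇒primitive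
  where
  open WeighingMatrix A k 0<k (λ i j → trans (sym (∑≗sum (λ l → A i l * A j l))) (AAᵀ≡kI i j))
  primitive⇒connected : Primitive A → Connected A
  primitive⇒connected ¬decomposable u v = decidable-stable (walk? A u v)
    (¬decomposable ∘ separation⇒decomposable ∘ unreachable⇒separation)
  connected⇒primitive : Connected A → Primitive A
  connected⇒primitive connected decomposable =
    separation⇒¬connected (decomposable⇒separation decomposable) connected
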